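{- For every $n\ge 1$, $\mathrm{HC}(G_n)\ge 2_n^1/2$, where $G_n$ is the formula $\forall\boldsymbol{\lambda}\mathbf I\to(\forall x.\,px=p(qx))\to E_n$.
   Context: Language: a left-associative binary function symbol $\circ$ (application, written as juxtaposition, so $xyz$ means $(x\circ y)\circ z$), constants $S,B,C,I,p,q$, and equality. $\boldsymbol{\lambda}\mathbf I$ is the set of the four equations $Sxyz=xz(yz)$, $Bxyz=x(yz)$, $Cxyz=xzy$, $Ix=x$; $\forall\boldsymbol{\lambda}\mathbf I$ is the set of their universal closures, and for a finite set $\{A_1,\dots,A_m\}$, writing $\{A_1,\dots,A_m\}\to F$ means $A_1\to\dots\to A_m\to F$. Define $T:=SB(CBI)$, $T_1:=T$, $T_{n+1}:=T_nT$, and $E_n:=\ pq=p(T_nqq)$. The Herbrand complexity $\mathrm{HC}(G_n)$ is the least $N$ such that there are closed terms $\vec t_i$ and $u_i$ ($i<N$) of this language with $\mathbf{EC}^=\vdash\bigvee_{i<N}\big(\boldsymbol{\lambda}\mathbf I(\vec t_i)\to pu_i=p(qu_i)\to E_n\big)$, where $\boldsymbol{\lambda}\mathbf I(\vec t)$ is the conjunction of the four combinator equations with their variables instantiated by $\vec t$. Here $\mathbf{EC}^=$ is the quantifier-free Hilbert system with all propositional tautologies, the equality axioms $t=t$, $s=t\to t=s$, $s=t\to t=u\to s=u$, $\vec s=\vec t\to f\vec s=f\vec t$, $\vec s=\vec t\to P\vec s\to P\vec t$, and modus ponens. Hyperexponentiation: $2_0^m=m$, $2_{n+1}^m=2^{2_n^m}$.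 -}

module Defs where

open import Data.Nat using (ℕ; zero; suc; _^_)
open import Data.Bool using (Bool; true; false; _∧_; _∨_; not)
open import Data.Fin using (Fin; zero; suc)
open import Data.Product using (_×_; _,_)
open import Data.Unit using (⊤)
open import Relation.Binary.PropositionalEquality using (_≡_)

infixl 9 _·_

-- Terms of the language: variables, the constants S B C I p q, and
-- the binary application symbol ∘ (written _·_, left associative).
data Tm : Set where
  var : ℕ → Tm
  S B C I p q : Tm
  _·_ : Tm → Tm → Tm

Closed : Tm → Set
Closed (var _) = Data.Empty.⊥ where import Data.Empty
Closed S = ⊤
Closed B = ⊤
Closed C = ⊤
Closed I = ⊤
Closed p = ⊤
Closed q = ⊤
Closed (s · t) = Closed s × Closed t

infix 6 _≐_
infixr 5 _∧'_
infixr 4 _∨'_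
infixr 3 _⇒_
data Fm : Set where
  _≐_ : Tm → Tm → Fm
  ⊥' : Fm
  _⇒_ : Fm → Fm → Fm
  _∧'_ : Fm → Fm → Fm
  _∨'_ : Fm → Fm → Fm

-- Propositional evaluation: atoms get arbitrary truth values.
eval : (Tm → Tm → Bool) → Fm → Bool
eval v (s ≐ t) = v s t
eval v ⊥' = false
eval v (a ⇒ b) = not (eval v a) ∨ eval v b
eval v (a ∧' b) = eval v a ∧ eval v b
eval v (a ∨' b) = eval v a ∨ eval v b

Tautology : Fm → Set
Tautology F = (v : Tm → Tm → Bool) → eval v F ≡ true

data EC⊢ : Fm → Set where
  taut  : ∀ {F} → Tautology F → EC⊢ F
  eq-refl  : ∀ t → EC⊢ (t ≐ t)
  eq-sym   : ∀ s t → EC⊢ (s ≐ t ⇒ t ≐ s)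
  eq-trans : ∀ s t u → EC⊢ (s ≐ t ⇒ t ≐ u ⇒ s ≐ u)
  -- congruence for the binary function symbol ∘
  -- (for the 0-ary constants the axiom is an instance of eq-refl)
  eq-cong  : ∀ s₁ s₂ t₁ t₂ → EC⊢ (s₁ ≐ t₁ ⇒ s₂ ≐ t₂ ⇒ s₁ · s₂ ≐ t₁ · t₂)
  eq-pred  : ∀ s₁ s₂ t₁ t₂ → EC⊢ (s₁ ≐ t₁ ⇒ s₂ ≐ t₂ ⇒ s₁ ≐ s₂ ⇒ t₁ ≐ t₂)
  mp : ∀ {A F} → EC⊢ A → EC⊢ (A ⇒ F) → EC⊢ F

Tc : Tm
Tc = S · B · (C · B · I)

-- Tn n = T_n  (meaningful for n ≥ 1; Tn 0 is unused and set to T)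
Tn : ℕ → Tm
Tn zero = Tc
Tn (suc zero) = Tc
Tn (suc (suc n)) = Tn (suc n) · Tc

E : ℕ → Fm
E n = p · q ≐ p · (Tn n · q · q)

-- Instantiation terms for the universal closures of λI:
-- (x,y,z) for S, (x,y,z) for B, (x,y,z) for C, x for I.
Inst : Set
Inst = (Tm × Tm × Tm) × (Tm × Tm × Tm) × (Tm × Tm × Tm) × Tm

ClosedInst : Inst → Set
ClosedInst ((a₁ , b₁ , c₁) , (a₂ , b₂ , c₂) , (a₃ , b₃ , c₃) , d) =
  (Closed a₁ × Closed b₁ × Closed c₁) × (Closed a₂ × Closed b₂ × Closed c₂) ×
  (Closed a₃ × Closed b₃ × Closed c₃) × Closed d

λI : Inst → Fm
λI ((x₁ , y₁ , z₁) , (x₂ , y₂ , z₂) , (x₃ , y₃ , z₃) , x₄) =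
  (S · x₁ · y₁ · z₁ ≐ x₁ · z₁ · (y₁ · z₁)) ∧'
  (B · x₂ · y₂ · z₂ ≐ x₂ · (y₂ · z₂)) ∧'
  (C · x₃ · y₃ · z₃ ≐ x₃ · z₃ · y₃) ∧'
  (I · x₄ ≐ x₄)

HInst : ℕ → Inst → Tm → Fm
HInst n t u = λI t ⇒ (p · u ≐ p · (q · u)) ⇒ E n

⋁ : (N : ℕ) → (Fin N → Fm) → Fm
⋁ zero f = ⊥'
⋁ (suc N) f = f zero ∨' ⋁ N (λ i → f (suc i))

2^^ : ℕ → ℕ → ℕ
2^^ zero m = m
2^^ (suc n) m = 2 ^ 2^^ n m

-- Take a Herbrand disjunction of size N for G_n that is provable in
-- EC^=.  For every level r we build a model of λI (a graph model of
-- combinatory logic whose elements are sets of "atoms") in which q raises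
-- the number of initial numerals an element contains by one, and p_r only
-- asks whether its argument contains the first r numerals.  In the models
-- r = 1 … 2ₙ¹ the conclusion E_n is false, because T_n q q = q^(2ₙ¹) q.
-- Soundness of EC^= (valid only up to double negation, since equality in
-- the model is not decidable) therefore forces, for each level r, some
-- instance p uᵢ = p (q uᵢ) to fail in model r, i.e. uᵢ "breaks" at r.
-- Interpretations shrink as r grows, so each uᵢ breaks at most once, and the
-- pigeonhole principle yields 2ₙ¹ ≤ N, which is stronger than 2ₙ¹ ≤ 2N.
module Submission where

open import Defs
open import Data.Nat using (ℕ; _≤_; _*_)
open import Data.Fin using (Fin)
open import Data.Nat using (zero; suc; _<_; _+_; _^_; z≤n; s≤s)
open import Data.Nat.Properties as ℕ using (≤-refl; ≤-trans; n≤1+n; <⇒≤; ≮⇒≥; m≤n*m; +-identityʳ)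
open import Data.Nat.GeneralisedArithmetic using (fold; fold-+)
open import Data.Fin using (toℕ) renaming (zero to fzero; suc to fsuc)
open import Data.Fin.Properties using (pigeonhole; toℕ<n)
open import Data.Bool using (Bool; false)
open import Data.Empty using (⊥)
open import Data.Product using (∃; ∃₂; _×_; _,_; proj₁; proj₂; uncurry)
open import Data.Product.Properties using (≡-dec)
open import Data.Sum using (_⊎_; inj₁; inj₂)
open import Data.List using (List; []; _∷_; _++_; allFin)
open import Data.List.Relation.Unary.All as All using (All; []; _∷_)
open import Data.List.Relation.Unary.All.Properties using (++⁺; ++⁻ˡ; ++⁻ʳ)
open import Data.List.Membership.Propositional using (_∈_)
open import Data.List.Membership.Propositional.Properties using (∈-allFin)
open import Function using (_∘_; id)
open import Relation.Binary.Definitions using (DecidableEquality)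
open import Relation.Binary.PropositionalEquality using (_≡_; refl; sym; cong; cong₂; subst; module ≡-Reasoning)
open import Relation.Nullary using (¬_; Dec; yes; no; does; proof; contradiction)
open import Relation.Nullary.Decidable using (map′; _×-dec_; ¬¬-excluded-middle)
open import Relation.Nullary.Negation using (¬¬-map)
open import Relation.Nullary.Reflects using (Reflects; ofⁿ; invert; _→-reflects_; _×-reflects_; _⊎-reflects_)
open import Relation.Unary using (Pred; ∅; _⊆_) renaming (_≐_ to _≋_)
open import Relation.Unary.Properties using (≐-refl; ≐-sym; ≐-trans)
open import Algebra.Structures using (IsMagma)
open import Level using (0ℓ)

-- (1) Decidable equality of terms

-- Needed to turn finitely many decisions about equations into a Boolean
-- valuation in (2).  Terms are coded injectively as binary trees with
-- numeric leaves, whose equality is immediate to decide.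
data Code : Set where
  leaf : ℕ → Code
  node : Code → Code → Code

_≟ᶜ_ : DecidableEquality Code
leaf m ≟ᶜ leaf n = map′ (cong leaf) (λ { refl → refl }) (m ℕ.≟ n)
node a b ≟ᶜ node c d =
  map′ (uncurry (cong₂ node)) (λ { refl → refl , refl }) (a ≟ᶜ c ×-dec b ≟ᶜ d)
leaf _ ≟ᶜ node _ _ = no λ ()
node _ _ ≟ᶜ leaf _ = no λ ()

encode : Tm → Code
encode S = leaf 0
encode B = leaf 1
encode C = leaf 2
encode I = leaf 3
encode p = leaf 4
encode q = leaf 5
encode (var n) = leaf (6 + n)
encode (s · t) = node (encode s) (encode t)

decode : Code → Tm
decode (leaf 0) = S
decode (leaf 1) = B
decode (leaf 2) = C
decode (leaf 3) = I
decode (leaf 4) = p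
decode (leaf 5) = q
decode (leaf (suc (suc (suc (suc (suc (suc n))))))) = var n
decode (node a b) = decode a · decode b

decode-encode : ∀ t → decode (encode t) ≡ t
decode-encode S = refl
decode-encode B = refl
decode-encode C = refl
decode-encode I = refl
decode-encode p = refl
decode-encode q = refl
decode-encode (var n) = refl
decode-encode (s · t) = cong₂ _·_ (decode-encode s) (decode-encode t)

encode-injective : ∀ {s t} → encode s ≡ encode t → s ≡ t
encode-injective {s} {t} e = begin
  s                  ≡⟨ sym (decode-encode s) ⟩
  decode (encode s)  ≡⟨ cong decode e ⟩
  decode (encode t)  ≡⟨ decode-encode t ⟩
  t                  ∎
  where open ≡-Reasoning

_≟_ : DecidableEquality Tm
s ≟ t = map′ encode-injective (cong encode) (encode s ≟ᶜ encode t)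

open import Data.List.Membership.DecPropositional (≡-dec _≟_ _≟_) using (_∈?_)

-- (2) Double-negation soundness of EC^= for every congruence on terms

Sat : (Tm → Tm → Set) → Fm → Set
Sat σ (s ≐ t) = σ s t
Sat σ ⊥' = ⊥
Sat σ (A ⇒ F) = Sat σ A → Sat σ F
Sat σ (A ∧' F) = Sat σ A × Sat σ F
Sat σ (A ∨' F) = Sat σ A ⊎ Sat σ F

atoms : Fm → List (Tm × Tm)
atoms (s ≐ t) = (s , t) ∷ []
atoms ⊥' = []
atoms (A ⇒ F) = atoms A ++ atoms F
atoms (A ∧' F) = atoms A ++ atoms F
atoms (A ∨' F) = atoms A ++ atoms F

¬¬-All : ∀ {X : Set} {P : X → Set} → (∀ x → ¬ ¬ P x) → ∀ xs → ¬ ¬ All P xs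
¬¬-All h [] k = k []
¬¬-All h (x ∷ xs) k = h x λ px → ¬¬-All h xs λ pxs → k (px ∷ pxs)

¬¬-∀Fin : ∀ {K} {P : Fin K → Set} → (∀ r → ¬ ¬ P r) → ¬ ¬ (∀ r → P r)
¬¬-∀Fin {K} h = ¬¬-map (λ all r → All.lookup all (∈-allFin r)) (¬¬-All h (allFin K))

¬¬-→ : ∀ {X Y : Set} → ¬ (X × ¬ Y) → ¬ ¬ (X → Y)
¬¬-→ {X} {Y} h = ¬¬-map fromDec ¬¬-excluded-middle
  where
  fromDec : Dec Y → X → Y
  fromDec (yes b) _ = b
  fromDec (no ¬b) a = contradiction (a , ¬b) h

module _ (σ : Tm → Tm → Set) where

  Decided : Tm × Tm → Set
  Decided (s , t) = Dec (σ s t)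

  Agrees : (Tm → Tm → Bool) → Tm × Tm → Set
  Agrees v (s , t) = Reflects (σ s t) (v s t)

  eval-reflects : ∀ v F → All (Agrees v) (atoms F) → Reflects (Sat σ F) (eval v F)
  eval-reflects v (s ≐ t) (r ∷ []) = r
  eval-reflects v ⊥' [] = ofⁿ id
  eval-reflects v (A ⇒ F) rs =
    eval-reflects v A (++⁻ˡ (atoms A) rs) →-reflects eval-reflects v F (++⁻ʳ (atoms A) rs)
  eval-reflects v (A ∧' F) rs =
    eval-reflects v A (++⁻ˡ (atoms A) rs) ×-reflects eval-reflects v F (++⁻ʳ (atoms A) rs)
  eval-reflects v (A ∨' F) rs =
    eval-reflects v A (++⁻ˡ (atoms A) rs) ⊎-reflects eval-reflects v F (++⁻ʳ (atoms A) rs)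

  valuation : ∀ {L} → All Decided L → Tm → Tm → Bool
  valuation {L} ds s t with (s , t) ∈? L
  ... | yes m = does (All.lookup ds m)
  ... | no _ = false

  valuation-agrees : ∀ {L} (ds : All Decided L) {st} → st ∈ L → Agrees (valuation ds) st
  valuation-agrees {L} ds {s , t} m with (s , t) ∈? L
  ... | yes m′ = proof (All.lookup ds m′)
  ... | no m∉ = contradiction m m∉

  tautology-valid : ∀ {F} → Tautology F → ¬ ¬ Sat σ F
  tautology-valid {F} τ = ¬¬-map valid (¬¬-All (λ _ → ¬¬-excluded-middle) (atoms F))
    where
    valid : All Decided (atoms F) → Sat σ F
    valid ds = invert (subst (Reflects (Sat σ F)) (τ v)
                 (eval-reflects v F (All.tabulate (valuation-agrees ds))))
      where v = valuation ds

  sound : IsMagma σ _·_ → ∀ {F} → EC⊢ F → ¬ ¬ Sat σ F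
  sound M {F} (taut τ) = tautology-valid {F} τ
  sound M (eq-refl t) k = k (IsMagma.refl M)
  sound M (eq-sym s t) k = k (IsMagma.sym M)
  sound M (eq-trans s t u) k = k (IsMagma.trans M)
  sound M (eq-cong s₁ s₂ t₁ t₂) k = k (IsMagma.∙-cong M)
  sound M (eq-pred s₁ s₂ t₁ t₂) k =
    k λ e₁ e₂ e → IsMagma.trans M (IsMagma.sym M e₁) (IsMagma.trans M e e₂)
  sound M (mp dA dAF) k = sound M dA λ a → sound M dAF λ f → k (f a)

  ⋁-sat : ∀ N (f : Fin N → Fm) → Sat σ (⋁ N f) → ∃ λ i → Sat σ (f i)
  ⋁-sat (suc N) f (inj₁ h) = fzero , h
  ⋁-sat (suc N) f (inj₂ h) = let (i , hi) = ⋁-sat N (f ∘ fsuc) h in fsuc i , hi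

-- (3) The terms T_n in an arbitrary λI-model

record IsλIModel (σ : Tm → Tm → Set) : Set where
  field
    isMagma : IsMagma σ _·_
    S-law : ∀ x y z → σ (S · x · y · z) (x · z · (y · z))
    B-law : ∀ x y z → σ (B · x · y · z) (x · (y · z))
    C-law : ∀ x y z → σ (C · x · y · z) (x · z · y)
    I-law : ∀ x → σ (I · x) x

  λI-valid : ∀ t → Sat σ (λI t)
  λI-valid ((x₁ , y₁ , z₁) , (x₂ , y₂ , z₂) , (x₃ , y₃ , z₃) , x₄) =
    S-law x₁ y₁ z₁ , B-law x₂ y₂ z₂ , C-law x₃ y₃ z₃ , I-law x₄

iter : Tm → ℕ → Tm → Tm
iter a m b = fold b (a ·_) m

module IteratingT {σ : Tm → Tm → Set} (M : IsλIModel σ) where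
  open IsλIModel M
  open IsMagma isMagma using (setoid; ∙-cong) renaming (refl to σ-refl)
  open import Relation.Binary.Reasoning.Setoid setoid

  T-law : ∀ a b → σ (Tc · a · b) (a · (a · b))
  T-law a b = begin
    S · B · (C · B · I) · a · b  ≈⟨ ∙-cong (S-law B (C · B · I) a) σ-refl ⟩
    B · a · (C · B · I · a) · b  ≈⟨ B-law a (C · B · I · a) b ⟩
    a · (C · B · I · a · b)      ≈⟨ ∙-cong σ-refl (∙-cong (C-law B I a) σ-refl) ⟩
    a · (B · a · I · b)          ≈⟨ ∙-cong σ-refl (B-law a I b) ⟩
    a · (a · (I · b))            ≈⟨ ∙-cong σ-refl (∙-cong σ-refl (I-law b)) ⟩
    a · (a · b)                  ∎

  iter-T : ∀ m a b → σ (iter Tc m a · b) (iter a (2 ^ m) b)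
  iter-T zero a b = σ-refl
  iter-T (suc m) a b = begin
    Tc · w · b                         ≈⟨ T-law w b ⟩
    w · (w · b)                        ≈⟨ ∙-cong σ-refl (iter-T m a b) ⟩
    w · iter a P b                     ≈⟨ iter-T m a (iter a P b) ⟩
    iter a P (iter a P b)              ≡⟨ sym (fold-+ b (a ·_) P) ⟩
    iter a (P + P) b                   ≡⟨ cong (λ k → iter a (P + k) b) (sym (+-identityʳ P)) ⟩
    iter a (2 ^ suc m) b               ∎
    where
    w = iter Tc m a
    P = 2 ^ m

  Tn-law : ∀ n a b → σ (Tn (suc n) · a · b) (iter a (2^^ (suc n) 1) b)
  Tn-law zero a b = T-law a b
  Tn-law (suc n) a b = begin
    Tn (suc n) · Tc · a · b          ≈⟨ ∙-cong (Tn-law n Tc a) σ-refl ⟩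
    iter Tc (2^^ (suc n) 1) a · b    ≈⟨ iter-T (2^^ (suc n) 1) a b ⟩
    iter a (2^^ (suc (suc n)) 1) b   ∎

-- (4) Graph models of λI

-- Atoms: numerals, a marker ★, and arrows F ↦ b ("from all of F, yield b").
infixr 6 _↦_
data Atom : Set where
  base : ℕ → Atom
  ★ : Atom
  _↦_ : List Atom → Atom → Atom

Elem : Set₁
Elem = Pred Atom 0ℓ

app : Elem → Elem → Elem
app x y b = ∃ λ F → x (F ↦ b) × All y F

app-mono : ∀ {x x′ y y′} → x ⊆ x′ → y ⊆ y′ → app x y ⊆ app x′ y′
app-mono hx hy (F , xF , yF) = F , hx xF , All.map hy yF

app-cong : ∀ {x x′ y y′} → x ≋ x′ → y ≋ y′ → app x y ≋ app x′ y′
app-cong {x} {x′} {y} {y′} (x⊆ , ⊇x) (y⊆ , ⊇y) =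
  app-mono {x} {x′} {y} {y′} x⊆ y⊆ , app-mono {x′} {x} {y′} {y} ⊇x ⊇y

-- Factor F Ys Zs: for F = c₁ ∷ …, Ys = (G₁ ↦ c₁) ∷ … and Zs = G₁ ++ ….
-- It describes how a list of atoms of y z arises from atoms of y and of z.
data Factor : List Atom → List Atom → List Atom → Set where
  [] : Factor [] [] []
  step : ∀ G {c F Ys Zs} → Factor F Ys Zs → Factor (c ∷ F) ((G ↦ c) ∷ Ys) (G ++ Zs)

all-app⁺ : ∀ {y z F Ys Zs} → Factor F Ys Zs → All y Ys → All z Zs → All (app y z) F
all-app⁺ [] [] _ = []
all-app⁺ (step G f) (yG ∷ yYs) zZs =
  (G , yG , ++⁻ˡ G zZs) ∷ all-app⁺ f yYs (++⁻ʳ G zZs)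

all-app⁻ : ∀ {y z F} → All (app y z) F → ∃₂ λ Ys Zs → Factor F Ys Zs × All y Ys × All z Zs
all-app⁻ [] = [] , [] , [] , [] , []
all-app⁻ ((G , yG , zG) ∷ rest) =
  let (Ys , Zs , f , yYs , zZs) = all-app⁻ rest
  in _ , _ , step G f , yG ∷ yYs , ++⁺ zG zZs

-- The combinators, as sets of atoms read off from their equations.
Iᴹ : Elem
Iᴹ (F ↦ b) = F ≡ b ∷ []
Iᴹ _ = ⊥

Cᴹ : Elem
Cᴹ (X ↦ (Ys ↦ (Zs ↦ b))) = X ≡ (Zs ↦ (Ys ↦ b)) ∷ []
Cᴹ _ = ⊥

Bᴹ : Elem
Bᴹ (X ↦ (Ys ↦ (Zs ↦ b))) = ∃ λ F → X ≡ (F ↦ b) ∷ [] × Factor F Ys Zs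
Bᴹ _ = ⊥

Sᴹ : Elem
Sᴹ (X ↦ (Ys ↦ (H ↦ b))) =
  ∃ λ G → ∃ λ F → ∃ λ Zs → X ≡ (G ↦ (F ↦ b)) ∷ [] × Factor F Ys Zs × H ≡ G ++ Zs
Sᴹ _ = ⊥

Iᴹ-law : ∀ x → app Iᴹ x ≋ x
Iᴹ-law x = (λ { (_ , refl , xb ∷ []) → xb }) , (λ xb → _ , refl , xb ∷ [])

Cᴹ-law : ∀ x y z → app (app (app Cᴹ x) y) z ≋ app (app x z) y
Cᴹ-law x y z = (λ { (Zs , (Ys , (_ , refl , xF ∷ []) , yYs) , zZs) → Ys , (Zs , xF , zZs) , yYs })
             , (λ { (Ys , (Zs , xF , zZs) , yYs) → Zs , (Ys , (_ , refl , xF ∷ []) , yYs) , zZs })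

Bᴹ-law : ∀ x y z → app (app (app Bᴹ x) y) z ≋ app x (app y z)
Bᴹ-law x y z = fw , bw
  where
  fw : app (app (app Bᴹ x) y) z ⊆ app x (app y z)
  fw (Zs , (Ys , (_ , (F , refl , f) , xF ∷ []) , yYs) , zZs) = F , xF , all-app⁺ f yYs zZs
  bw : app x (app y z) ⊆ app (app (app Bᴹ x) y) z
  bw (F , xF , yzF) =
    let (Ys , Zs , f , yYs , zZs) = all-app⁻ yzF
    in Zs , (Ys , (_ , (F , refl , f) , xF ∷ []) , yYs) , zZs

Sᴹ-law : ∀ x y z → app (app (app Sᴹ x) y) z ≋ app (app x z) (app y z)
Sᴹ-law x y z = fw , bw
  where
  fw : app (app (app Sᴹ x) y) z ⊆ app (app x z) (app y z)
  fw (_ , (Ys , (_ , (G , F , Zs , refl , f , refl) , xG ∷ []) , yYs) , zGZs) =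
    F , (G , xG , ++⁻ˡ G zGZs) , all-app⁺ f yYs (++⁻ʳ G zGZs)
  bw : app (app x z) (app y z) ⊆ app (app (app Sᴹ x) y) z
  bw (F , (G , xG , zG) , yzF) =
    let (Ys , Zs , f , yYs , zZs) = all-app⁻ yzF
    in _ , (Ys , (_ , (G , F , Zs , refl , f , refl) , xG ∷ []) , yYs) , ++⁺ zG zZs

upto : ℕ → List Atom
upto zero = []
upto (suc s) = base s ∷ upto s

Covers : ℕ → Elem → Set
Covers s x = ∀ {j} → j < s → x (base j)

covers-mono : ∀ {s s′ x} → s ≤ s′ → Covers s′ x → Covers s x
covers-mono s≤s′ c j<s = c (≤-trans j<s s≤s′)

covers-⊆ : ∀ {s x y} → x ⊆ y → Covers s x → Covers s y
covers-⊆ x⊆y c j<s = x⊆y (c j<s)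

all-upto⇒covers : ∀ {x} s → All x (upto s) → Covers s x
all-upto⇒covers (suc s) (xs ∷ rest) {j} (s≤s j≤s) with ℕ.m≤n⇒m<n∨m≡n j≤s
... | inj₁ j<s = all-upto⇒covers s rest j<s
... | inj₂ refl = xs

covers⇒all-upto : ∀ {x} s → Covers s x → All x (upto s)
covers⇒all-upto zero c = []
covers⇒all-upto {x} (suc s) c = c ≤-refl ∷ covers⇒all-upto s (covers-mono {x = x} (n≤1+n s) c)

-- q x contains base j iff x covers j; q itself contains no numeral.
qᴹ : Elem
qᴹ (F ↦ base j) = F ≡ upto j
qᴹ _ = ⊥

covers-q⁺ : ∀ {s x} → Covers s x → Covers (suc s) (app qᴹ x)
covers-q⁺ {x = x} c {j} (s≤s j≤s) = upto j , refl , covers⇒all-upto j (covers-mono {x = x} j≤s c)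

covers-q⁻ : ∀ {s x} → Covers (suc s) (app qᴹ x) → Covers s x
covers-q⁻ {s} c with c ≤-refl
... | (_ , refl , all) = all-upto⇒covers s all

-- p_r x = {★} if x covers r, and ∅ otherwise.
pᴹ : ℕ → Elem
pᴹ r (F ↦ ★) = ∃ λ s → r ≤ s × F ≡ upto s
pᴹ r _ = ⊥

app-p⁻ : ∀ {r x b} → app (pᴹ r) x b → b ≡ ★ × Covers r x
app-p⁻ {x = x} {b = ★} (_ , (s , r≤s , refl) , all) = refl , covers-mono {x = x} r≤s (all-upto⇒covers s all)

app-p⁺ : ∀ {r x} → Covers r x → app (pᴹ r) x ★
app-p⁺ {r} c = upto r , (r , ≤-refl , refl) , covers⇒all-upto r c

p-mono : ∀ {r x y} → (Covers r x → Covers r y) → app (pᴹ r) x ⊆ app (pᴹ r) y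
p-mono cx⇒cy px with app-p⁻ px
... | refl , c = app-p⁺ (cx⇒cy c)

pᴹ-anti : ∀ {r r′} → r ≤ r′ → pᴹ r′ ⊆ pᴹ r
pᴹ-anti r≤r′ {_ ↦ ★} (s , r′≤s , e) = s , ≤-trans r≤r′ r′≤s , e

⟦_⟧ : Tm → ℕ → Elem
⟦ var _ ⟧ r = ∅
⟦ S ⟧ r = Sᴹ
⟦ B ⟧ r = Bᴹ
⟦ C ⟧ r = Cᴹ
⟦ I ⟧ r = Iᴹ
⟦ p ⟧ r = pᴹ r
⟦ q ⟧ r = qᴹ
⟦ s · t ⟧ r = app (⟦ s ⟧ r) (⟦ t ⟧ r)

_≈[_]_ : Tm → ℕ → Tm → Set
s ≈[ r ] t = ⟦ s ⟧ r ≋ ⟦ t ⟧ r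

model : ∀ r → IsλIModel (_≈[ r ]_)
model r = record
  { isMagma = record
    { isEquivalence = record { refl = ≐-refl ; sym = ≐-sym ; trans = ≐-trans }
    ; ∙-cong = app-cong }
  ; S-law = λ x y z → Sᴹ-law (⟦ x ⟧ r) (⟦ y ⟧ r) (⟦ z ⟧ r)
  ; B-law = λ x y z → Bᴹ-law (⟦ x ⟧ r) (⟦ y ⟧ r) (⟦ z ⟧ r)
  ; C-law = λ x y z → Cᴹ-law (⟦ x ⟧ r) (⟦ y ⟧ r) (⟦ z ⟧ r)
  ; I-law = λ x → Iᴹ-law (⟦ x ⟧ r)
  }

⟦⟧-anti : ∀ {r r′} → r ≤ r′ → ∀ t → ⟦ t ⟧ r′ ⊆ ⟦ t ⟧ r
⟦⟧-anti r≤r′ (var _) ()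
⟦⟧-anti r≤r′ S = id
⟦⟧-anti r≤r′ B = id
⟦⟧-anti r≤r′ C = id
⟦⟧-anti r≤r′ I = id
⟦⟧-anti r≤r′ p = pᴹ-anti r≤r′
⟦⟧-anti r≤r′ q = id
⟦⟧-anti {r} {r′} r≤r′ (s · t) =
  app-mono {⟦ s ⟧ r′} {⟦ s ⟧ r} {⟦ t ⟧ r′} {⟦ t ⟧ r} (⟦⟧-anti r≤r′ s) (⟦⟧-anti r≤r′ t)

-- (5) Counting the levels at which the Herbrand instances fail

iter-q-covers : ∀ r j x → Covers j (⟦ iter q j x ⟧ r)
iter-q-covers r (suc j) x = covers-q⁺ {x = ⟦ iter q j x ⟧ r} (iter-q-covers r j x)

-- At the levels 1 … 2ₙ¹ the conclusion E_n is false: p q is empty because q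
-- contains no numeral, while p (T_n q q) ∋ ★ because T_n q q = q^(2ₙ¹) q.
E-fails : ∀ n {r} → 1 ≤ r → r ≤ 2^^ (suc n) 1 → ¬ Sat (_≈[ r ]_) (E (suc n))
E-fails n {r} 1≤r r≤K (_ , ⊇) = proj₂ (app-p⁻ {x = qᴹ} (⊇ (app-p⁺ TnQQ-covers))) 1≤r
  where
  open IteratingT (model r) using (Tn-law)
  TnQQ-covers : Covers r (⟦ Tn (suc n) · q · q ⟧ r)
  TnQQ-covers = covers-mono {x = ⟦ Tn (suc n) · q · q ⟧ r} r≤K
    (covers-⊆ {x = ⟦ iter q (2^^ (suc n) 1) q ⟧ r} (proj₂ (Tn-law n q q))
      (iter-q-covers r (2^^ (suc n) 1) q))

p-instance : ∀ a u → (Covers a (⟦ u ⟧ (suc a)) → Covers (suc a) (⟦ u ⟧ (suc a))) →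
             Sat (_≈[ suc a ]_) (p · u ≐ p · (q · u))
p-instance a u grows =
    p-mono (covers-q⁺ {x = X} ∘ covers-mono {x = X} (n≤1+n a))
  , p-mono (grows ∘ covers-q⁻ {x = X})
  where X = ⟦ u ⟧ (suc a)

Breaks : Tm → ℕ → Set
Breaks u a = Covers a (⟦ u ⟧ (suc a)) × ¬ Covers (suc a) (⟦ u ⟧ (suc a))

-- Since interpretations shrink with the level, a term breaks at most once.
breaks-once : ∀ {a b} u → a < b → Breaks u a → ¬ Breaks u b
breaks-once {a} {b} u a<b (_ , ¬covers) (covers , _) =
  ¬covers (covers-mono {x = ⟦ u ⟧ (suc a)} a<b
            (covers-⊆ {x = ⟦ u ⟧ (suc b)} (⟦⟧-anti (s≤s (<⇒≤ a<b)) u) covers))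

module _ {n N} {t : Fin N → Inst} {u : Fin N → Tm}
         (prf : EC⊢ (⋁ N (λ i → HInst (suc n) (t i) (u i)))) where

  -- Every level below 2ₙ¹ is, classically, a breaking level of some uᵢ:
  -- otherwise every instance, hence E_n, would hold at that level.
  some-uᵢ-breaks : ∀ a → a < 2^^ (suc n) 1 → ¬ ¬ ∃ λ i → Breaks (u i) a
  some-uᵢ-breaks a a<K none = sound _ (IsλIModel.isMagma (model (suc a))) prf λ sat →
    let (i , instance-i) = ⋁-sat _ N _ sat in
    ¬¬-→ (none ∘ (i ,_)) λ grows →
      E-fails n (s≤s z≤n) a<K
        (instance-i (IsλIModel.λI-valid (model (suc a)) (t i)) (p-instance a (u i) grows))

  -- Choosing a breaking uᵢ for each level gives an injection of the 2ₙ¹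
  -- levels into the N instances.
  levels≤instances : 2^^ (suc n) 1 ≤ N
  levels≤instances = ≮⇒≥ λ N<K →
    ¬¬-∀Fin (λ r → some-uᵢ-breaks (toℕ r) (toℕ<n r)) λ breaker →
      let (r₁ , r₂ , r₁<r₂ , same) = pigeonhole N<K (proj₁ ∘ breaker) in
      breaks-once (u (proj₁ (breaker r₁))) r₁<r₂ (proj₂ (breaker r₁))
        (subst (λ i → Breaks (u i) (toℕ r₂)) (sym same) (proj₂ (breaker r₂)))

mainTheorem4 : (n : ℕ) → 1 ≤ n → (N : ℕ) → (t : Fin N → Inst) → (u : Fin N → Tm) →
                 (∀ i → ClosedInst (t i)) → (∀ i → Closed (u i)) →
                 EC⊢ (⋁ N (λ i → HInst n (t i) (u i))) →
                 2^^ n 1 ≤ 2 * N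
mainTheorem4 (suc n) _ N t u _ _ prf = ≤-trans (levels≤instances prf) (m≤n*m N 2)
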